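{- Every extended X-tree, and hence every X-tree, is subhamiltonian.
   Context: All graphs are finite and simple. An X-tree is the plane graph obtained from a complete binary tree drawn in the plane with the root at the top (each internal vertex branching down to a left and a right child) by adding, for each depth level, a horizontal path joining, in left-to-right order, all vertices at the same distance from the root. An extended X-tree is obtained from an X-tree by adding, for each of these horizontal paths, an edge joining its two endpoints (forming a cycle), unless those two vertices are already adjacent. A graph is subhamiltonian if it is a subgraph of a planar graph having a cycle through all its vertices. -}

module Defs where

open import Data.Nat as ℕ using (ℕ; zero; suc; _^_)
open import Data.Fin as Fin using (Fin; toℕ)
open import Data.Product using (Σ; ∃; ∃-syntax; _×_; _,_; proj₁; proj₂)
open import Data.Sum using (_⊎_)
open import Data.List using (List; []; _∷_; _++_; [_]; length; lookup)
open import Data.Rational using (ℚ; 0ℚ; 1ℚ; _+_; _*_; _-_; _≤_)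
open import Relation.Binary.PropositionalEquality using (_≡_)
open import Relation.Nullary using (¬_)
open import Function.Definitions using (Injective)

record Graph : Set₁ where
  field
    V   : Set
    Adj : V → V → Set

-- X-trees and extended X-trees of depth d (levels 0 .. d).
-- Vertex (k , j) is the j-th vertex (from the left, j < 2^k) at depth k.

XVertex : ℕ → Set
XVertex d = Σ (Fin (suc d)) λ k → Fin (2 ^ toℕ k)

data XTreeStep : ℕ → ℕ → ℕ → ℕ → Set where
  leftChild  : ∀ k j → XTreeStep k j (suc k) (2 ℕ.* j)
  rightChild : ∀ k j → XTreeStep k j (suc k) (suc (2 ℕ.* j))
  horizontal : ∀ k j → XTreeStep k j k (suc j)

-- extended X-tree: additionally join the two ends (k , 0) and (k , 2^k - 1)
-- of each horizontal path, unless already adjacent (i.e. unless 2^k - 1 ≤ 1)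
data ExtStep : ℕ → ℕ → ℕ → ℕ → Set where
  base : ∀ {k j k' j'} → XTreeStep k j k' j' → ExtStep k j k' j'
  wrap : ∀ k j → suc j ≡ 2 ^ k → 2 ℕ.≤ j → ExtStep k 0 k j

lift : ∀ {d} → (ℕ → ℕ → ℕ → ℕ → Set) → XVertex d → XVertex d → Set
lift R (k , j) (k' , j') =
  R (toℕ k) (toℕ j) (toℕ k') (toℕ j') ⊎ R (toℕ k') (toℕ j') (toℕ k) (toℕ j)

XTree : ℕ → Graph
XTree d = record { V = XVertex d ; Adj = lift XTreeStep }

ExtXTree : ℕ → Graph
ExtXTree d = record { V = XVertex d ; Adj = lift ExtStep }

-- Planarity of a finite simple graph on Fin m, via drawings in the plane
-- whose edges are polygonal arcs (with rational bend points).

Point : Set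
Point = ℚ × ℚ

OnSeg : Point → Point → Point → Set
OnSeg (x₁ , x₂) (p₁ , p₂) (q₁ , q₂) =
  ∃[ t ] (0ℚ ≤ t × t ≤ 1ℚ ×
          x₁ ≡ p₁ + t * (q₁ - p₁) × x₂ ≡ p₂ + t * (q₂ - p₂))

segments : List Point → List (Point × Point)
segments []             = []
segments (p ∷ [])       = []
segments (p ∷ q ∷ rest) = (p , q) ∷ segments (q ∷ rest)

OnChain : Point → List Point → Set
OnChain x ps = ∃[ i ] OnSeg x (proj₁ (lookup (segments ps) i)) (proj₂ (lookup (segments ps) i))

SimpleChain : List Point → Set
SimpleChain ps = ∀ (i j : Fin (length (segments ps))) x →
  toℕ i ℕ.< toℕ j →
  OnSeg x (proj₁ (lookup (segments ps) i)) (proj₂ (lookup (segments ps) i)) →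
  OnSeg x (proj₁ (lookup (segments ps) j)) (proj₂ (lookup (segments ps) j)) →
  (suc (toℕ i) ≡ toℕ j × x ≡ proj₂ (lookup (segments ps) i))

record SimpleGraphOn (m : ℕ) (H : Fin m → Fin m → Set) : Set where
  field
    sym   : ∀ {u v} → H u v → H v u
    irrfl : ∀ {u} → ¬ H u u

record PlanarDrawing (m : ℕ) (H : Fin m → Fin m → Set) : Set where
  field
    pos     : Fin m → Point
    pos-inj : Injective _≡_ _≡_ pos
    bends   : Fin m → Fin m → List Point
  arc : Fin m → Fin m → List Point
  arc u v = pos u ∷ bends u v ++ [ pos v ]
  field
    arc-simple : ∀ u v → toℕ u ℕ.< toℕ v → H u v → SimpleChain (arc u v)
    arc-avoids : ∀ u v w x → toℕ u ℕ.< toℕ v → H u v →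
      OnChain x (arc u v) → x ≡ pos w → w ≡ u ⊎ w ≡ v
    arcs-disjoint : ∀ u v u' v' x →
      toℕ u ℕ.< toℕ v → H u v → toℕ u' ℕ.< toℕ v' → H u' v' →
      ¬ (u ≡ u' × v ≡ v') →
      OnChain x (arc u v) → OnChain x (arc u' v') →
      ∃[ w ] (x ≡ pos w × (w ≡ u ⊎ w ≡ v) × (w ≡ u' ⊎ w ≡ v'))

Planar : (m : ℕ) → (Fin m → Fin m → Set) → Set
Planar m H = PlanarDrawing m H

record HamiltonianCycle (m : ℕ) (H : Fin m → Fin m → Set) : Set where
  field
    three≤m : 3 ℕ.≤ m
    c       : Fin m → Fin m
    c-inj   : Injective _≡_ _≡_ c
    c-adj   : ∀ i j → (suc (toℕ i) ≡ toℕ j ⊎ (suc (toℕ i) ≡ m × toℕ j ≡ 0)) →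
              H (c i) (c j)

Subhamiltonian : Graph → Set₁
Subhamiltonian G =
  ∃[ m ] Σ (Fin m → Fin m → Set) λ H →
    SimpleGraphOn m H × Planar m H × HamiltonianCycle m H ×
    Σ (Graph.V G → Fin m) λ f →
      Injective _≡_ _≡_ f × (∀ u v → Graph.Adj G u v → H (f u) (f v))

module Submission where

-- Lay the vertices of the X-tree on a line with the root in the middle: depth e + 1 of the root's left
-- subtree occupies the offsets [2^e, 2^(e+1)) to the left of the root, its right subtree the mirror image
-- to the right, each level read outwards for even e and inwards for odd e.  With one free position added
-- at each end, the consecutive pairs of positions together with the pair of ends form a Hamiltonian cycle.
-- Every X-tree edge then joins neighbouring positions, or is a tree edge inside one half (these nest
-- because consecutive levels run in opposite directions), or is a chord joining the two positions at the
-- same offset (the middle edge and the wrap-around edge of a level).  Putting a tree edge from depth e + 1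
-- down on page `isEven e`, and a chord over offset o on page `isEven ⌊log₂ (o + 1)⌋`, no two edges on one
-- page cross.  Such a two-page book embedding is planar: draw position i at (2i, 0) and an edge as a tent
-- above or below the line whose slope is its length; tents on one page are disjoint or nested, and nested
-- tents have different slopes, so two edges meet only in a common end vertex.

open import Data.Bool using (Bool; true; false; not)
open import Data.Empty using (⊥-elim)
open import Data.Fin using (Fin; toℕ; fromℕ<)
import Data.Fin.Properties as Fin
open import Data.List using (List; []; _∷_; _++_; [_])
open import Data.Product using (∃; _×_; _,_; proj₁; proj₂; swap; uncurry)
open import Data.Sum using (_⊎_; inj₁; inj₂) renaming (map to ⊎-map; swap to swap⊎)
open import Function using (id; _∘_)
open import Function.Definitions using (Injective)
open import Relation.Binary.Definitions using (tri<; tri≈; tri>)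
open import Relation.Binary.PropositionalEquality hiding ([_])
open import Relation.Nullary using (¬_; Dec; yes; no)

open import Defs

module RationalFacts where

  open import Data.Nat as ℕ using (ℕ; zero; suc; z≤n; s≤s)
  import Data.Nat.Properties as ℕ
  open import Data.Rational
  open import Data.Rational.Properties
  open import Data.Rational.Solver
  open +-*-Solver

  ≤-byDifference : ∀ {p q} r → 0ℚ ≤ r → q - p ≡ r → p ≤ q
  ≤-byDifference {p} {q} r 0≤r refl =
    subst₂ _≤_ (+-identityʳ p) (solve 2 (λ p q → p :+ (q :- p) := q) refl p q) (+-monoʳ-≤ p 0≤r)

  <-byDifference : ∀ {p q} r → 0ℚ < r → q - p ≡ r → p < q
  <-byDifference {p} {q} r 0<r refl =
    subst₂ _<_ (+-identityʳ p) (solve 2 (λ p q → p :+ (q :- p) := q) refl p q) (+-monoʳ-< p 0<r)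

  p≤q⇒0≤q-p : ∀ {p q} → p ≤ q → 0ℚ ≤ q - p
  p≤q⇒0≤q-p {p} {q} le = subst (_≤ q - p) (+-inverseʳ p) (+-monoˡ-≤ (- p) le)

  p<q⇒0<q-p : ∀ {p q} → p < q → 0ℚ < q - p
  p<q⇒0<q-p {p} {q} lt = subst (_< q - p) (+-inverseʳ p) (+-monoˡ-< (- p) lt)

  0≤p⇒0≤q⇒0≤p*q : ∀ {p q} → 0ℚ ≤ p → 0ℚ ≤ q → 0ℚ ≤ p * q
  0≤p⇒0≤q⇒0≤p*q {p} {q} 0≤p 0≤q = subst (_≤ p * q) (*-zeroʳ p) (*-monoˡ-≤-nonNeg p {{nonNegative 0≤p}} 0≤q)

  0≤-p⇒p≤0 : ∀ {p} → 0ℚ ≤ - p → p ≤ 0ℚ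
  0≤-p⇒p≤0 {p} 0≤-p = ≤-byDifference (- p) 0≤-p (+-identityˡ (- p))

  0≤p⇒0≤q⇒p+q≤0⇒p≡0×q≡0 : ∀ {p q} → 0ℚ ≤ p → 0ℚ ≤ q → p + q ≤ 0ℚ → p ≡ 0ℚ × q ≡ 0ℚ
  0≤p⇒0≤q⇒p+q≤0⇒p≡0×q≡0 {p} {q} 0≤p 0≤q p+q≤0 =
    ≤-antisym (≤-trans (≤-byDifference q 0≤q (solve 2 (λ p q → (p :+ q) :- p := q) refl p q)) p+q≤0) 0≤p ,
    ≤-antisym (≤-trans (≤-byDifference p 0≤p (solve 2 (λ p q → (p :+ q) :- q := p) refl p q)) p+q≤0) 0≤q

  0<w⇒0≤-[w*x]⇒x≡0 : ∀ {w x} → 0ℚ < w → 0ℚ ≤ x → 0ℚ ≤ - (w * x) → x ≡ 0ℚ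
  0<w⇒0≤-[w*x]⇒x≡0 {w} {x} 0<w 0≤x 0≤-wx with <-cmp 0ℚ x
  ... | tri< 0<x _ _ = ⊥-elim (<-irrefl refl (<-≤-trans 0<wx (0≤-p⇒p≤0 0≤-wx)))
    where
    0<wx : 0ℚ < w * x
    0<wx = subst (_< w * x) (*-zeroʳ w) (*-monoʳ-<-pos w {{positive 0<w}} 0<x)
  ... | tri≈ _ 0≡x _ = sym 0≡x
  ... | tri> _ _ x<0 = ⊥-elim (<-irrefl refl (<-≤-trans x<0 0≤x))

  p-q≡0⇒p≡q : ∀ {p q} → p - q ≡ 0ℚ → p ≡ q
  p-q≡0⇒p≡q {p} {q} e = begin
    p             ≡⟨ solve 2 (λ p q → p := (p :- q) :+ q) refl p q ⟩
    (p - q) + q   ≡⟨ cong (_+ q) e ⟩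
    0ℚ + q        ≡⟨ +-identityˡ q ⟩
    q             ∎
    where open ≡-Reasoning

  sign : Bool → ℚ
  sign true  = 1ℚ
  sign false = - 1ℚ

  sign-*-cancelˡ : ∀ s {p q} → sign s * p ≡ sign s * q → p ≡ q
  sign-*-cancelˡ true {p} {q} e = trans (sym (*-identityˡ p)) (trans e (*-identityˡ q))
  sign-*-cancelˡ false {p} {q} e = neg-injective (begin
    - p          ≡⟨ solve 1 (λ p → :- p := :- con 1ℚ :* p) refl p ⟩
    - 1ℚ * p     ≡⟨ e ⟩
    - 1ℚ * q     ≡⟨ solve 1 (λ q → :- con 1ℚ :* q := :- q) refl q ⟩
    - q          ∎)
    where open ≡-Reasoning

  fromℕ : ℕ → ℚ
  fromℕ zero    = 0ℚ
  fromℕ (suc n) = 1ℚ + fromℕ n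

  fromℕ-+ : ∀ m n → fromℕ (m ℕ.+ n) ≡ fromℕ m + fromℕ n
  fromℕ-+ zero    n = sym (+-identityˡ (fromℕ n))
  fromℕ-+ (suc m) n = trans (cong (1ℚ +_) (fromℕ-+ m n)) (sym (+-assoc 1ℚ (fromℕ m) (fromℕ n)))

  fromℕ-mono-≤ : ∀ {m n} → m ℕ.≤ n → fromℕ m ≤ fromℕ n
  fromℕ-mono-≤ {n = zero}  z≤n = ≤-refl
  fromℕ-mono-≤ {n = suc n} z≤n = +-mono-≤ (<⇒≤ (positive⁻¹ 1ℚ)) (fromℕ-mono-≤ {n = n} z≤n)
  fromℕ-mono-≤ (s≤s m≤n) = +-monoʳ-≤ 1ℚ (fromℕ-mono-≤ m≤n)

  fromℕ-mono-< : ∀ {m n} → m ℕ.< n → fromℕ m < fromℕ n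
  fromℕ-mono-< {m} {suc n} (s≤s m≤n) = ≤-<-trans (fromℕ-mono-≤ m≤n)
    (<-byDifference 1ℚ (positive⁻¹ 1ℚ) (solve 1 (λ q → (con 1ℚ :+ q) :- q := con 1ℚ) refl (fromℕ n)))

  fromℕ-double-injective : ∀ {m n} → fromℕ m + fromℕ m ≡ fromℕ n + fromℕ n → m ≡ n
  fromℕ-double-injective {m} {n} e with ℕ.<-cmp m n
  ... | tri< m<n _ _ = ⊥-elim (<-irrefl e (+-mono-< (fromℕ-mono-< m<n) (fromℕ-mono-< m<n)))
  ... | tri≈ _ m≡n _ = m≡n
  ... | tri> _ _ n<m = ⊥-elim (<-irrefl (sym e) (+-mono-< (fromℕ-mono-< n<m) (fromℕ-mono-< n<m)))

module Tents where

  open import Data.Rational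
  open import Data.Rational.Properties
  open import Data.Rational.Solver
  open +-*-Solver
  open RationalFacts

  -- Abscissae are doubled so that the apex of the tent over [2A, 2B] needs no division.
  spine : ℚ → Point
  spine A = (A + A , 0ℚ)

  apex : ℚ → ℚ → Bool → Point
  apex A B s = (A + B , sign s * ((B - A) * (B - A)))

  record OnTent (A B : ℚ) (s : Bool) (x y : ℚ) : Set where
    field
      run     : ℚ
      0≤run   : 0ℚ ≤ run
      run≤left  : run ≤ x - (A + A)
      run≤right : run ≤ (B + B) - x
      run≡    : run ≡ x - (A + A) ⊎ run ≡ (B + B) - x
      y≡      : y ≡ sign s * ((B - A) * run)

  onLeftSlope : ∀ A B s x y → 0ℚ < B - A → OnSeg (x , y) (spine A) (apex A B s) →
    (A + A ≤ x) × (x ≤ A + B) × (y ≡ sign s * ((B - A) * (x - (A + A))))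
  onLeftSlope A B s x y 0<w (t , 0≤t , t≤1 , refl , refl) =
    ≤-byDifference (t * (B - A)) (0≤p⇒0≤q⇒0≤p*q 0≤t (<⇒≤ 0<w))
      (solve 3 (λ A B t → ((A :+ A) :+ t :* ((A :+ B) :- (A :+ A))) :- (A :+ A) := t :* (B :- A)) refl A B t) ,
    ≤-byDifference ((1ℚ - t) * (B - A)) (0≤p⇒0≤q⇒0≤p*q (p≤q⇒0≤q-p t≤1) (<⇒≤ 0<w))
      (solve 3 (λ A B t → (A :+ B) :- ((A :+ A) :+ t :* ((A :+ B) :- (A :+ A))) := (con 1ℚ :- t) :* (B :- A)) refl A B t) ,
    solve 4 (λ A B t S → con 0ℚ :+ t :* (S :* ((B :- A) :* (B :- A)) :- con 0ℚ)
                       := S :* ((B :- A) :* (((A :+ A) :+ t :* ((A :+ B) :- (A :+ A))) :- (A :+ A)))) refl A B t (sign s)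

  onRightSlope : ∀ A B s x y → 0ℚ < B - A → OnSeg (x , y) (apex A B s) (spine B) →
    (A + B ≤ x) × (x ≤ B + B) × (y ≡ sign s * ((B - A) * ((B + B) - x)))
  onRightSlope A B s x y 0<w (t , 0≤t , t≤1 , refl , refl) =
    ≤-byDifference (t * (B - A)) (0≤p⇒0≤q⇒0≤p*q 0≤t (<⇒≤ 0<w))
      (solve 3 (λ A B t → ((A :+ B) :+ t :* ((B :+ B) :- (A :+ B))) :- (A :+ B) := t :* (B :- A)) refl A B t) ,
    ≤-byDifference ((1ℚ - t) * (B - A)) (0≤p⇒0≤q⇒0≤p*q (p≤q⇒0≤q-p t≤1) (<⇒≤ 0<w))
      (solve 3 (λ A B t → (B :+ B) :- ((A :+ B) :+ t :* ((B :+ B) :- (A :+ B))) := (con 1ℚ :- t) :* (B :- A)) refl A B t) ,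
    solve 4 (λ A B t S → S :* ((B :- A) :* (B :- A)) :+ t :* (con 0ℚ :- S :* ((B :- A) :* (B :- A)))
                       := S :* ((B :- A) :* ((B :+ B) :- ((A :+ B) :+ t :* ((B :+ B) :- (A :+ B)))))) refl A B t (sign s)

  onLeftSlope⇒OnTent : ∀ {A B s x y} → (A + A ≤ x) × (x ≤ A + B) × (y ≡ sign s * ((B - A) * (x - (A + A)))) →
    OnTent A B s x y
  onLeftSlope⇒OnTent {A} {B} {x = x} (2A≤x , x≤A+B , y≡) = record
    { run = x - (A + A) ; 0≤run = p≤q⇒0≤q-p 2A≤x ; run≤left = ≤-refl
    ; run≤right = ≤-byDifference (((A + B) - x) + ((A + B) - x)) (+-mono-≤ (p≤q⇒0≤q-p x≤A+B) (p≤q⇒0≤q-p x≤A+B))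
        (solve 3 (λ A B x → ((B :+ B) :- x) :- (x :- (A :+ A)) := ((A :+ B) :- x) :+ ((A :+ B) :- x)) refl A B x)
    ; run≡ = inj₁ refl ; y≡ = y≡ }

  onRightSlope⇒OnTent : ∀ {A B s x y} → (A + B ≤ x) × (x ≤ B + B) × (y ≡ sign s * ((B - A) * ((B + B) - x))) →
    OnTent A B s x y
  onRightSlope⇒OnTent {A} {B} {x = x} (A+B≤x , x≤2B , y≡) = record
    { run = (B + B) - x ; 0≤run = p≤q⇒0≤q-p x≤2B
    ; run≤left = ≤-byDifference ((x - (A + B)) + (x - (A + B))) (+-mono-≤ (p≤q⇒0≤q-p A+B≤x) (p≤q⇒0≤q-p A+B≤x))
        (solve 3 (λ A B x → (x :- (A :+ A)) :- ((B :+ B) :- x) := (x :- (A :+ B)) :+ (x :- (A :+ B))) refl A B x)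
    ; run≤right = ≤-refl ; run≡ = inj₂ refl ; y≡ = y≡ }

  open OnTent

  tents-apart : ∀ {A B A' B' s s' x y} (T : OnTent A B s x y) (T' : OnTent A' B' s' x y) → B ≤ A' →
    run T ≡ 0ℚ × run T' ≡ 0ℚ
  tents-apart {B = B} {A'} {x = x} T T' B≤A' = 0≤p⇒0≤q⇒p+q≤0⇒p≡0×q≡0 (0≤run T) (0≤run T') runs≤0
    where
    r = run T
    r' = run T'
    runs≤0 : r + r' ≤ 0ℚ
    runs≤0 = ≤-byDifference _
      (+-mono-≤ (+-mono-≤ (p≤q⇒0≤q-p (run≤right T)) (p≤q⇒0≤q-p (run≤left T')))
                (+-mono-≤ (p≤q⇒0≤q-p B≤A') (p≤q⇒0≤q-p B≤A')))
      (solve 5 (λ r r' x B A' → con 0ℚ :- (r :+ r')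
                 := (((B :+ B) :- x) :- r) :+ ((x :- (A' :+ A')) :- r') :+ ((A' :- B) :+ (A' :- B))) refl r r' x B A')

  tents-oppositePages : ∀ {A B A' B' x y} → 0ℚ < B - A → 0ℚ < B' - A' →
    (T : OnTent A B true x y) (T' : OnTent A' B' false x y) → run T ≡ 0ℚ × run T' ≡ 0ℚ
  tents-oppositePages {A} {B} {A'} {B'} 0<w 0<w' T T' =
    0<w⇒0≤-[w*x]⇒x≡0 0<w (0≤run T)
      (subst (0ℚ ≤_) (sym -wr≡w'r') (0≤p⇒0≤q⇒0≤p*q (<⇒≤ 0<w') (0≤run T'))) ,
    0<w⇒0≤-[w*x]⇒x≡0 0<w' (0≤run T')
      (subst (0ℚ ≤_) wr≡-w'r' (0≤p⇒0≤q⇒0≤p*q (<⇒≤ 0<w) (0≤run T)))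
    where
    wr≡-w'r' : (B - A) * run T ≡ - ((B' - A') * run T')
    wr≡-w'r' = begin
      (B - A) * run T             ≡⟨ sym (*-identityˡ _) ⟩
      1ℚ * ((B - A) * run T)      ≡⟨ trans (sym (y≡ T)) (y≡ T') ⟩
      - 1ℚ * ((B' - A') * run T') ≡⟨ solve 1 (λ X → :- con 1ℚ :* X := :- X) refl _ ⟩
      - ((B' - A') * run T')      ∎
      where open ≡-Reasoning
    -wr≡w'r' : - ((B - A) * run T) ≡ (B' - A') * run T'
    -wr≡w'r' = trans (cong -_ wr≡-w'r') (solve 1 (λ X → :- (:- X) := X) refl _)

  -- Nesting gives r' ≤ r, while equal heights W r = W' r' with W' < W give r < r' unless r' = 0.
  tents-nested : ∀ {A B A' B' s x y} → 0ℚ < B - A → A ≤ A' → B' ≤ B → 0ℚ < (B - A) - (B' - A') →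
    (T : OnTent A B s x y) (T' : OnTent A' B' s x y) → run T ≡ 0ℚ × run T' ≡ 0ℚ
  tents-nested {A} {B} {A'} {B'} {s} {x} 0<w A≤A' B'≤B 0<w-w' T T' = r≡0 , r'≡0
    where
    w = B - A
    w' = B' - A'
    r = run T
    r' = run T'
    r'≤r : 0ℚ ≤ r - r'
    r'≤r with run≡ T
    ... | inj₁ refl = ≤-byDifference _
      (+-mono-≤ (p≤q⇒0≤q-p (run≤left T')) (+-mono-≤ (p≤q⇒0≤q-p A≤A') (p≤q⇒0≤q-p A≤A')))
      (solve 4 (λ r' x A A' → ((x :- (A :+ A)) :- r') :- con 0ℚ
                             := ((x :- (A' :+ A')) :- r') :+ ((A' :- A) :+ (A' :- A))) refl r' x A A')
    ... | inj₂ refl = ≤-byDifference _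
      (+-mono-≤ (p≤q⇒0≤q-p (run≤right T')) (+-mono-≤ (p≤q⇒0≤q-p B'≤B) (p≤q⇒0≤q-p B'≤B)))
      (solve 4 (λ r' x B B' → (((B :+ B) :- x) :- r') :- con 0ℚ
                             := (((B' :+ B') :- x) :- r') :+ ((B :- B') :+ (B :- B'))) refl r' x B B')
    wr≡w'r' : w * r ≡ w' * r'
    wr≡w'r' = sign-*-cancelˡ s (trans (sym (y≡ T)) (y≡ T'))
    w[r-r']≡-[[w-w']r'] : w * (r - r') ≡ - ((w - w') * r')
    w[r-r']≡-[[w-w']r'] = begin
      w * (r - r')        ≡⟨ solve 3 (λ w r r' → w :* (r :- r') := w :* r :- w :* r') refl w r r' ⟩
      w * r - w * r'      ≡⟨ cong (_- w * r') wr≡w'r' ⟩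
      w' * r' - w * r'    ≡⟨ solve 3 (λ w w' r' → w' :* r' :- w :* r' := :- ((w :- w') :* r')) refl w w' r' ⟩
      - ((w - w') * r')   ∎
      where open ≡-Reasoning
    r'≡0 : r' ≡ 0ℚ
    r'≡0 = 0<w⇒0≤-[w*x]⇒x≡0 0<w-w' (0≤run T')
      (subst (0ℚ ≤_) w[r-r']≡-[[w-w']r'] (0≤p⇒0≤q⇒0≤p*q (<⇒≤ 0<w) r'≤r))
    r≡0 : r ≡ 0ℚ
    r≡0 = 0<w⇒0≤-[w*x]⇒x≡0 0<w (0≤run T)
      (≤-reflexive (sym (cong -_ (trans wr≡w'r' (trans (cong (w' *_) r'≡0) (*-zeroʳ w'))))))

  run≡0⇒foot : ∀ {A B s x y} (T : OnTent A B s x y) → run T ≡ 0ℚ → y ≡ 0ℚ × (x ≡ A + A ⊎ x ≡ B + B)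
  run≡0⇒foot {A} {B} {s} {x} {y} T r≡0 = y≡0 , foot (run≡ T)
    where
    y≡0 : y ≡ 0ℚ
    y≡0 = trans (y≡ T) (trans (cong (λ r → sign s * ((B - A) * r)) r≡0)
                              (trans (cong (sign s *_) (*-zeroʳ (B - A))) (*-zeroʳ (sign s))))
    foot : run T ≡ x - (A + A) ⊎ run T ≡ (B + B) - x → x ≡ A + A ⊎ x ≡ B + B
    foot (inj₁ e) = inj₁ (p-q≡0⇒p≡q (trans (sym e) r≡0))
    foot (inj₂ e) = inj₂ (sym (p-q≡0⇒p≡q (trans (sym e) r≡0)))

module TwoPageBook where

  open import Data.Nat as ℕ using (ℕ; s≤s)
  import Data.Nat.Properties as ℕ
  open import Data.Rational using (ℚ; 0ℚ; _+_; _-_; -_; _*_; _≤_; _<_)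
  import Data.Rational.Properties as ℚ
  open import Data.Rational.Solver
  open +-*-Solver
  open RationalFacts
  open Tents
  open OnTent

  Crossing : ℕ → ℕ → ℕ → ℕ → Set
  Crossing a b a' b' = a ℕ.< a' × a' ℕ.< b × b ℕ.< b'

  record TwoPageBookEmbedding (m : ℕ) (E : ℕ → ℕ → Set) : Set where
    field
      page       : ℕ → ℕ → Bool
      endpoints< : ∀ {a b} → E a b → a ℕ.< b
      noCrossing : ∀ {a b a' b'} → b ℕ.< m → b' ℕ.< m → E a b → E a' b' →
                   page a b ≡ page a' b' → ¬ Crossing a b a' b'

  data Uncrossed (a b a' b' : ℕ) : Set where
    before     : b ℕ.≤ a' → Uncrossed a b a' b'
    after      : b' ℕ.≤ a → Uncrossed a b a' b'
    encloses   : a ℕ.≤ a' → b' ℕ.≤ b → b' ℕ.+ a ℕ.< b ℕ.+ a' → Uncrossed a b a' b'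
    enclosedBy : a' ℕ.≤ a → b ℕ.≤ b' → b ℕ.+ a' ℕ.< b' ℕ.+ a → Uncrossed a b a' b'

  uncrossed : ∀ {a b a' b'} → ¬ (a ≡ a' × b ≡ b') → ¬ Crossing a b a' b' → ¬ Crossing a' b' a b →
    Uncrossed a b a' b'
  uncrossed {a} {b} {a'} {b'} ≢ ¬ab×a'b' ¬a'b'×ab with ℕ.<-cmp a a'
  ... | tri< a<a' _ _ with ℕ.≤-<-connex b a'
  ...   | inj₁ b≤a' = before b≤a'
  ...   | inj₂ a'<b = encloses (ℕ.<⇒≤ a<a') b'≤b (ℕ.+-mono-≤-< b'≤b a<a')
    where b'≤b = ℕ.≮⇒≥ (λ b<b' → ¬ab×a'b' (a<a' , a'<b , b<b'))
  uncrossed {a} {b} {a'} {b'} ≢ _ _ | tri≈ _ refl _ with ℕ.<-cmp b b'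
  ... | tri< b<b' _ _ = enclosedBy ℕ.≤-refl (ℕ.<⇒≤ b<b') (ℕ.+-monoˡ-< a b<b')
  ... | tri≈ _ b≡b' _ = ⊥-elim (≢ (refl , b≡b'))
  ... | tri> _ _ b'<b = encloses ℕ.≤-refl (ℕ.<⇒≤ b'<b) (ℕ.+-monoˡ-< a b'<b)
  uncrossed {a} {b} {a'} {b'} ≢ ¬ab×a'b' ¬a'b'×ab | tri> _ _ a'<a with ℕ.≤-<-connex b' a
  ...   | inj₁ b'≤a = after b'≤a
  ...   | inj₂ a<b' = enclosedBy (ℕ.<⇒≤ a'<a) b≤b' (ℕ.+-mono-≤-< b≤b' a'<a)
    where b≤b' = ℕ.≮⇒≥ (λ b'<b → ¬a'b'×ab (a'<a , a<b' , b'<b))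

  width>0 : ∀ {a b} → a ℕ.< b → 0ℚ < fromℕ b - fromℕ a
  width>0 a<b = p<q⇒0<q-p (fromℕ-mono-< a<b)

  width-difference>0 : ∀ {a b a' b'} → b' ℕ.+ a ℕ.< b ℕ.+ a' →
    0ℚ < (fromℕ b - fromℕ a) - (fromℕ b' - fromℕ a')
  width-difference>0 {a} {b} {a'} {b'} lt = subst (0ℚ <_)
    (solve 4 (λ a b a' b' → (b :+ a') :- (b' :+ a) := (b :- a) :- (b' :- a')) refl
      (fromℕ a) (fromℕ b) (fromℕ a') (fromℕ b'))
    (p<q⇒0<q-p (subst₂ _<_ (fromℕ-+ b' a) (fromℕ-+ b a') (fromℕ-mono-< lt)))

  SpineTent : ℕ → ℕ → Bool → ℚ → ℚ → Set
  SpineTent a b = OnTent (fromℕ a) (fromℕ b)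

  uncrossedTents-meetOnSpine : ∀ {a b a' b' s x y} → a ℕ.< b → a' ℕ.< b' → Uncrossed a b a' b' →
    (T : SpineTent a b s x y) (T' : SpineTent a' b' s x y) → run T ≡ 0ℚ × run T' ≡ 0ℚ
  uncrossedTents-meetOnSpine _ _ (before b≤a') T T' = tents-apart T T' (fromℕ-mono-≤ b≤a')
  uncrossedTents-meetOnSpine _ _ (after b'≤a) T T' = swap (tents-apart T' T (fromℕ-mono-≤ b'≤a))
  uncrossedTents-meetOnSpine {a} {b} {a'} {b'} a<b _ (encloses a≤a' b'≤b lt) T T' =
    tents-nested (width>0 a<b) (fromℕ-mono-≤ a≤a') (fromℕ-mono-≤ b'≤b)
      (width-difference>0 {a} {b} {a'} {b'} lt) T T'
  uncrossedTents-meetOnSpine {a} {b} {a'} {b'} _ a'<b' (enclosedBy a'≤a b≤b' lt) T T' =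
    swap (tents-nested (width>0 a'<b') (fromℕ-mono-≤ a'≤a) (fromℕ-mono-≤ b≤b')
      (width-difference>0 {a'} {b'} {a} {b} lt) T' T)

  tents-meetOnSpine : ∀ {a b a' b' s s' x y} → a ℕ.< b → a' ℕ.< b' → (s ≡ s' → Uncrossed a b a' b') →
    (T : SpineTent a b s x y) (T' : SpineTent a' b' s' x y) → run T ≡ 0ℚ × run T' ≡ 0ℚ
  tents-meetOnSpine {s = true}  {false} a<b a'<b' _ T T' = tents-oppositePages (width>0 a<b) (width>0 a'<b') T T'
  tents-meetOnSpine {s = false} {true}  a<b a'<b' _ T T' = swap (tents-oppositePages (width>0 a'<b') (width>0 a<b) T' T)
  tents-meetOnSpine {s = true}  {true}  a<b a'<b' u T T' = uncrossedTents-meetOnSpine a<b a'<b' (u refl) T T'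
  tents-meetOnSpine {s = false} {false} a<b a'<b' u T T' = uncrossedTents-meetOnSpine a<b a'<b' (u refl) T T'

  Undirected : ∀ {m} → (ℕ → ℕ → Set) → Fin m → Fin m → Set
  Undirected E u v = E (toℕ u) (toℕ v) ⊎ E (toℕ v) (toℕ u)

  undirected-simple : ∀ {m E} → (∀ {a b} → E a b → a ℕ.< b) → SimpleGraphOn m (Undirected E)
  undirected-simple < = record
    { sym   = λ { (inj₁ e) → inj₂ e ; (inj₂ e) → inj₁ e }
    ; irrfl = λ { (inj₁ e) → ℕ.<-irrefl refl (< e) ; (inj₂ e) → ℕ.<-irrefl refl (< e) } }

  module _ {m E} (book : TwoPageBookEmbedding m E) where

    open TwoPageBookEmbedding book

    vertexPoint : Fin m → Point
    vertexPoint u = spine (fromℕ (toℕ u))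

    vertexPoint-injective : ∀ {u v} → vertexPoint u ≡ vertexPoint v → u ≡ v
    vertexPoint-injective e = Fin.toℕ-injective (fromℕ-double-injective (cong proj₁ e))

    bends : Fin m → Fin m → List Point
    bends u v = apex (fromℕ (toℕ u)) (fromℕ (toℕ v)) (page (toℕ u) (toℕ v)) ∷ []

    arc : Fin m → Fin m → List Point
    arc u v = vertexPoint u ∷ bends u v ++ [ vertexPoint v ]

    forward : ∀ {u v : Fin m} → toℕ u ℕ.< toℕ v → Undirected E u v → E (toℕ u) (toℕ v)
    forward _   (inj₁ e) = e
    forward u<v (inj₂ e) = ⊥-elim (ℕ.<-asym u<v (endpoints< e))

    onArc⇒onTent : ∀ {u v} x → toℕ u ℕ.< toℕ v → OnChain x (arc u v) →
      SpineTent (toℕ u) (toℕ v) (page (toℕ u) (toℕ v)) (proj₁ x) (proj₂ x)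
    onArc⇒onTent {u} {v} (x , y) u<v (Fin.zero , on) =
      onLeftSlope⇒OnTent (onLeftSlope (fromℕ (toℕ u)) (fromℕ (toℕ v)) (page (toℕ u) (toℕ v)) x y (width>0 u<v) on)
    onArc⇒onTent {u} {v} (x , y) u<v (Fin.suc Fin.zero , on) =
      onRightSlope⇒OnTent (onRightSlope (fromℕ (toℕ u)) (fromℕ (toℕ v)) (page (toℕ u) (toℕ v)) x y (width>0 u<v) on)

    foot⇒endpoint : ∀ {x} w {u v} → x ≡ proj₁ (vertexPoint w) →
      x ≡ proj₁ (vertexPoint u) ⊎ x ≡ proj₁ (vertexPoint v) → w ≡ u ⊎ w ≡ v
    foot⇒endpoint w x≡w (inj₁ x≡u) = inj₁ (Fin.toℕ-injective (fromℕ-double-injective (trans (sym x≡w) x≡u)))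
    foot⇒endpoint w x≡w (inj₂ x≡v) = inj₂ (Fin.toℕ-injective (fromℕ-double-injective (trans (sym x≡w) x≡v)))

    arc-simple : ∀ u v → toℕ u ℕ.< toℕ v → Undirected E u v → SimpleChain (arc u v)
    arc-simple u v u<v _ Fin.zero (Fin.suc Fin.zero) (x , y) _ onL onR = refl , cong₂ _,_ x≡A+B y≡apex
      where
      A = fromℕ (toℕ u)
      B = fromℕ (toℕ v)
      s = page (toℕ u) (toℕ v)
      left = onLeftSlope A B s x y (width>0 u<v) onL
      x≡A+B : x ≡ A + B
      x≡A+B = ℚ.≤-antisym (proj₁ (proj₂ left)) (proj₁ (onRightSlope A B s x y (width>0 u<v) onR))
      y≡apex : y ≡ sign s * ((B - A) * (B - A))
      y≡apex = begin
        y                                         ≡⟨ proj₂ (proj₂ left) ⟩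
        sign s * ((B - A) * (x - (A + A)))        ≡⟨ cong (λ z → sign s * ((B - A) * (z - (A + A)))) x≡A+B ⟩
        sign s * ((B - A) * ((A + B) - (A + A)))  ≡⟨ cong (λ z → sign s * ((B - A) * z)) A+B-2A≡B-A ⟩
        sign s * ((B - A) * (B - A))              ∎
        where
        open ≡-Reasoning
        A+B-2A≡B-A : (A + B) - (A + A) ≡ B - A
        A+B-2A≡B-A = solve 2 (λ A B → (A :+ B) :- (A :+ A) := B :- A) refl A B
    arc-simple u v _ _ (Fin.suc Fin.zero) (Fin.suc Fin.zero) _ (s≤s ()) _ _

    arc-avoids : ∀ u v w x → toℕ u ℕ.< toℕ v → Undirected E u v → OnChain x (arc u v) → x ≡ vertexPoint w →
      w ≡ u ⊎ w ≡ v
    arc-avoids u v w x u<v _ on refl = foot⇒endpoint w refl (proj₂ (run≡0⇒foot T run≡0))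
      where
      s = page (toℕ u) (toℕ v)
      w' = fromℕ (toℕ v) - fromℕ (toℕ u)
      T = onArc⇒onTent x u<v on
      w'*run≡0 : w' * run T ≡ 0ℚ
      w'*run≡0 = sign-*-cancelˡ s (trans (sym (y≡ T)) (sym (ℚ.*-zeroʳ (sign s))))
      run≡0 : run T ≡ 0ℚ
      run≡0 = 0<w⇒0≤-[w*x]⇒x≡0 (width>0 u<v) (0≤run T) (ℚ.≤-reflexive (sym (cong -_ w'*run≡0)))

    arcs-disjoint : ∀ u v u' v' x → toℕ u ℕ.< toℕ v → Undirected E u v →
      toℕ u' ℕ.< toℕ v' → Undirected E u' v' → ¬ (u ≡ u' × v ≡ v') → OnChain x (arc u v) → OnChain x (arc u' v') →
      ∃ λ w → x ≡ vertexPoint w × (w ≡ u ⊎ w ≡ v) × (w ≡ u' ⊎ w ≡ v')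
    arcs-disjoint u v u' v' (x , y) u<v uv u'<v' u'v' ≢ on on' =
      common (run≡0⇒foot T (proj₁ runs≡0)) (run≡0⇒foot T' (proj₂ runs≡0))
      where
      T = onArc⇒onTent (x , y) u<v on
      T' = onArc⇒onTent (x , y) u'<v' on'
      ≢ℕ : ¬ (toℕ u ≡ toℕ u' × toℕ v ≡ toℕ v')
      ≢ℕ (e , e') = ≢ (Fin.toℕ-injective e , Fin.toℕ-injective e')
      samePage⇒uncrossed : page (toℕ u) (toℕ v) ≡ page (toℕ u') (toℕ v') →
        Uncrossed (toℕ u) (toℕ v) (toℕ u') (toℕ v')
      samePage⇒uncrossed same = uncrossed ≢ℕ
        (noCrossing (Fin.toℕ<n v) (Fin.toℕ<n v') (forward u<v uv) (forward u'<v' u'v') same)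
        (noCrossing (Fin.toℕ<n v') (Fin.toℕ<n v) (forward u'<v' u'v') (forward u<v uv) (sym same))
      runs≡0 : run T ≡ 0ℚ × run T' ≡ 0ℚ
      runs≡0 = tents-meetOnSpine u<v u'<v' samePage⇒uncrossed T T'
      common : y ≡ 0ℚ × (x ≡ proj₁ (vertexPoint u) ⊎ x ≡ proj₁ (vertexPoint v)) →
               y ≡ 0ℚ × (x ≡ proj₁ (vertexPoint u') ⊎ x ≡ proj₁ (vertexPoint v')) →
               ∃ λ w → (x , y) ≡ vertexPoint w × (w ≡ u ⊎ w ≡ v) × (w ≡ u' ⊎ w ≡ v')
      common (y≡0 , inj₁ x≡u) (_ , x≡u'∨v') = u , cong₂ _,_ x≡u y≡0 , inj₁ refl , foot⇒endpoint u x≡u x≡u'∨v'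
      common (y≡0 , inj₂ x≡v) (_ , x≡u'∨v') = v , cong₂ _,_ x≡v y≡0 , inj₂ refl , foot⇒endpoint v x≡v x≡u'∨v'

    bookEmbedding⇒planar : Planar m (Undirected E)
    bookEmbedding⇒planar = record
      { pos = vertexPoint ; pos-inj = vertexPoint-injective ; bends = bends
      ; arc-simple = arc-simple ; arc-avoids = arc-avoids ; arcs-disjoint = arcs-disjoint }

open import Data.Nat
open import Data.Nat.Properties
open import Data.Nat.Logarithm using (⌊log₂_⌋; ⌊log₂⌋-mono-≤; ⌊log₂⌊n/2⌋⌋≡⌊log₂n⌋∸1)
open import Data.Bool.Properties using (not-¬)
open TwoPageBook using (Crossing; TwoPageBookEmbedding; Undirected; undirected-simple; bookEmbedding⇒planar)

m+n≡p+q⇒m<p⇒q<n : ∀ {m n p q} → m + n ≡ p + q → m < p → q < n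
m+n≡p+q⇒m<p⇒q<n {m} {n} {p} {q} eq m<p = ≰⇒> λ n≤q → <-irrefl eq (+-mono-<-≤ m<p n≤q)

m+n≡p+q⇒n<q⇒p<m : ∀ {m n p q} → m + n ≡ p + q → n < q → p < m
m+n≡p+q⇒n<q⇒p<m {m} {n} {p} {q} eq n<q = ≰⇒> λ m≤p → <-irrefl eq (+-mono-≤-< m≤p n<q)

module DyadicBlocks where

  isEven : ℕ → Bool
  isEven zero    = true
  isEven (suc n) = not (isEven n)

  isEven-suc≢ : ∀ n → isEven n ≢ isEven (suc n)
  isEven-suc≢ n = not-¬ refl

  isEven-cases : ∀ n → isEven n ≡ true ⊎ isEven n ≡ false
  isEven-cases n with isEven n
  ... | true  = inj₁ refl
  ... | false = inj₂ refl

  2^suc : ∀ e → 2 ^ suc e ≡ 2 ^ e + 2 ^ e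
  2^suc e = cong (2 ^ e +_) (+-identityʳ (2 ^ e))

  InBlock : ℕ → ℕ → Set
  InBlock e n = 2 ^ e ≤ n × n < 2 ^ suc e

  ⌊n/2⌋+⌊n/2⌋≤n : ∀ n → ⌊ n /2⌋ + ⌊ n /2⌋ ≤ n
  ⌊n/2⌋+⌊n/2⌋≤n n = ≤-trans (+-monoʳ-≤ ⌊ n /2⌋ (⌊n/2⌋≤⌈n/2⌉ n)) (≤-reflexive (⌊n/2⌋+⌈n/2⌉≡n n))

  ⌊log₂⌋-block : ∀ e {n} → InBlock e n → ⌊log₂ n ⌋ ≡ e
  ⌊log₂⌋-block zero {suc zero} _ = refl
  ⌊log₂⌋-block zero {suc (suc n)} (_ , s≤s (s≤s ()))
  ⌊log₂⌋-block (suc e) {n} (lo , hi) = begin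
    ⌊log₂ n ⌋              ≡⟨ sym (m∸n+n≡m 1≤log) ⟩
    ⌊log₂ n ⌋ ∸ 1 + 1      ≡⟨ cong (_+ 1) (sym (⌊log₂⌊n/2⌋⌋≡⌊log₂n⌋∸1 n)) ⟩
    ⌊log₂ ⌊ n /2⌋ ⌋ + 1    ≡⟨ cong (_+ 1) (⌊log₂⌋-block e (half-lo , half-hi)) ⟩
    e + 1                  ≡⟨ +-comm e 1 ⟩
    suc e                  ∎
    where
    open ≡-Reasoning
    1≤log : 1 ≤ ⌊log₂ n ⌋
    1≤log = ⌊log₂⌋-mono-≤ {2} (≤-trans (^-monoʳ-≤ 2 {1} {suc e} (s≤s z≤n)) lo)
    half-lo : 2 ^ e ≤ ⌊ n /2⌋
    half-lo = subst (_≤ ⌊ n /2⌋) (sym (n≡⌊n+n/2⌋ (2 ^ e))) (⌊n/2⌋-mono {2 ^ e + 2 ^ e} (subst (_≤ n) (2^suc e) lo))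
    half-hi : ⌊ n /2⌋ < 2 ^ suc e
    half-hi = ≰⇒> λ big → <-irrefl refl (<-≤-trans hi
      (≤-trans (≤-reflexive (2^suc (suc e))) (≤-trans (+-mono-≤ big big) (⌊n/2⌋+⌊n/2⌋≤n n))))

  block-unique : ∀ {e e' n} → InBlock e n → InBlock e' n → e ≡ e'
  block-unique {e} {e'} b b' = trans (sym (⌊log₂⌋-block e b)) (⌊log₂⌋-block e' b')

  blockParity : ℕ → Bool
  blockParity n = isEven ⌊log₂ n ⌋

  blockParity-block : ∀ {e n} → InBlock e n → blockParity n ≡ isEven e
  blockParity-block {e} b = cong isEven (⌊log₂⌋-block e b)

module Offsets where

  open DyadicBlocks

  mirror : ℕ → ℕ → ℕ
  mirror h j = h ∸ suc j

  mirror+suc : ∀ {h j} → j < h → mirror h j + suc j ≡ h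
  mirror+suc = m∸n+n≡m

  mirror-< : ∀ {h j} → j < h → mirror h j < h
  mirror-< {suc h} {j} _ = s≤s (m∸n≤m h j)

  mirror-suc : ∀ {h j} → suc j < h → mirror h j ≡ suc (mirror h (suc j))
  mirror-suc {h} {j} sj<h = +-cancelʳ-≡ (suc j) _ _ (begin
    mirror h j + suc j                 ≡⟨ mirror+suc (<-trans (n<1+n j) sj<h) ⟩
    h                                  ≡⟨ sym (mirror+suc sj<h) ⟩
    mirror h (suc j) + suc (suc j)     ≡⟨ +-suc (mirror h (suc j)) (suc j) ⟩
    suc (mirror h (suc j)) + suc j     ∎)
    where open ≡-Reasoning

  mirror-antitone : ∀ {h j j'} → j < j' → j' < h → mirror h j' < mirror h j
  mirror-antitone {h} {j} {j'} j<j' j'<h = +-cancelʳ-< (suc j) _ _ (begin-strict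
    mirror h j' + suc j     <⟨ +-monoʳ-< (mirror h j') (s≤s j<j') ⟩
    mirror h j' + suc j'    ≡⟨ mirror+suc j'<h ⟩
    h                       ≡⟨ sym (mirror+suc (<-trans j<j' j'<h)) ⟩
    mirror h j + suc j      ∎)
    where open ≤-Reasoning

  orient : Bool → ℕ → ℕ → ℕ
  orient true  h j = j
  orient false h j = mirror h j

  opaque
    offset : ℕ → ℕ → ℕ
    offset e j = 2 ^ e + orient (isEven e) (2 ^ e) j

    offset-orient : ∀ e j → offset e j ≡ 2 ^ e + orient (isEven e) (2 ^ e) j
    offset-orient e j = refl

  offset-even : ∀ {e} j → isEven e ≡ true → offset e j ≡ 2 ^ e + j
  offset-even {e} j p = trans (offset-orient e j) (cong (λ b → 2 ^ e + orient b (2 ^ e) j) p)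

  offset-odd : ∀ {e} j → isEven e ≡ false → offset e j ≡ 2 ^ e + mirror (2 ^ e) j
  offset-odd {e} j p = trans (offset-orient e j) (cong (λ b → 2 ^ e + orient b (2 ^ e) j) p)

  orient-< : ∀ b {h j} → j < h → orient b h j < h
  orient-< true  j<h = j<h
  orient-< false j<h = mirror-< j<h

  offset-inBlock : ∀ e {j} → j < 2 ^ e → InBlock e (offset e j)
  offset-inBlock e {j} j< = subst (InBlock e) (sym (offset-orient e j))
    (m≤m+n (2 ^ e) _ ,
     subst (2 ^ e + orient (isEven e) (2 ^ e) j <_) (sym (2^suc e)) (+-monoʳ-< (2 ^ e) (orient-< (isEven e) j<)))

  offset-monotone : ∀ {e j j'} → isEven e ≡ true → j < j' → offset e j < offset e j'
  offset-monotone {e} {j} {j'} p j<j' =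
    subst₂ _<_ (sym (offset-even j p)) (sym (offset-even j' p)) (+-monoʳ-< (2 ^ e) j<j')

  offset-antitone : ∀ {e j j'} → isEven e ≡ false → j < j' → j' < 2 ^ e → offset e j' < offset e j
  offset-antitone {e} {j} {j'} p j<j' j'< =
    subst₂ _<_ (sym (offset-odd j' p)) (sym (offset-odd j p)) (+-monoʳ-< (2 ^ e) (mirror-antitone j<j' j'<))

  offset-injective : ∀ {e j j'} → j < 2 ^ e → j' < 2 ^ e → offset e j ≡ offset e j' → j ≡ j'
  offset-injective {e} {j} {j'} j< j'< eq with <-cmp j j' | isEven-cases e
  ... | tri< j<j' _ _ | inj₁ p = ⊥-elim (<-irrefl eq (offset-monotone {e} p j<j'))
  ... | tri< j<j' _ _ | inj₂ p = ⊥-elim (<-irrefl (sym eq) (offset-antitone {e} p j<j' j'<))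
  ... | tri≈ _ j≡j' _ | _     = j≡j'
  ... | tri> _ _ j'<j | inj₁ p = ⊥-elim (<-irrefl (sym eq) (offset-monotone {e} p j'<j))
  ... | tri> _ _ j'<j | inj₂ p = ⊥-elim (<-irrefl eq (offset-antitone {e} p j'<j j<))

  offset-suc : ∀ {e j} → suc j < 2 ^ e →
    offset e (suc j) ≡ suc (offset e j) ⊎ offset e j ≡ suc (offset e (suc j))
  offset-suc {e} {j} sj< with isEven-cases e
  ... | inj₁ p = inj₁ (begin
    offset e (suc j)                      ≡⟨ offset-even (suc j) p ⟩
    2 ^ e + suc j                         ≡⟨ +-suc (2 ^ e) j ⟩
    suc (2 ^ e + j)                       ≡⟨ cong suc (sym (offset-even j p)) ⟩
    suc (offset e j)                      ∎)
    where open ≡-Reasoning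
  ... | inj₂ p = inj₂ (begin
    offset e j                            ≡⟨ offset-odd j p ⟩
    2 ^ e + mirror (2 ^ e) j              ≡⟨ cong (2 ^ e +_) (mirror-suc sj<) ⟩
    2 ^ e + suc (mirror (2 ^ e) (suc j))  ≡⟨ +-suc (2 ^ e) _ ⟩
    suc (2 ^ e + mirror (2 ^ e) (suc j))  ≡⟨ cong suc (sym (offset-odd (suc j) p)) ⟩
    suc (offset e (suc j))                ∎)
    where open ≡-Reasoning

  data IsChild (j : ℕ) : ℕ → Set where
    left  : IsChild j (2 * j)
    right : IsChild j (suc (2 * j))

  2*suc : ∀ j → 2 * suc j ≡ suc (suc (2 * j))
  2*suc j = *-suc 2 j

  child≤ : ∀ {j jc} → IsChild j jc → jc ≤ suc (2 * j)
  child≤ left  = n≤1+n _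
  child≤ right = ≤-refl

  child≥ : ∀ {j jc} → IsChild j jc → 2 * j ≤ jc
  child≥ left  = ≤-refl
  child≥ right = n≤1+n _

  child-< : ∀ {e j jc} → j < 2 ^ e → IsChild j jc → jc < 2 ^ suc e
  child-< {e} {j} j< c = ≤-trans (s≤s (child≤ c)) (subst (_≤ 2 * 2 ^ e) (2*suc j) (*-monoʳ-≤ 2 j<))

  child-monotone : ∀ {j jc j' jc'} → IsChild j jc → IsChild j' jc' → j < j' → jc < jc'
  child-monotone {j} {j' = j'} c c' j<j' =
    ≤-trans (s≤s (child≤ c)) (≤-trans (subst (_≤ 2 * j') (2*suc j) (*-monoʳ-≤ 2 j<j')) (child≥ c'))

  double-mirror+suc : ∀ {h j} → j < h → 2 * h ≡ 2 * mirror h j + 2 * suc j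
  double-mirror+suc {h} {j} j<h = trans (cong (2 *_) (sym (mirror+suc j<h))) (*-distribˡ-+ 2 (mirror h j) (suc j))

  mirror-child : ∀ {h j jc} → j < h → IsChild j jc → IsChild (mirror h j) (mirror (2 * h) jc)
  mirror-child {h} {j} j<h left = subst (IsChild R) (sym (+-cancelʳ-≡ (suc (2 * j)) _ _ (begin
    mirror (2 * h) (2 * j) + suc (2 * j)  ≡⟨ mirror+suc 2j<2h ⟩
    2 * h                                 ≡⟨ double-mirror+suc j<h ⟩
    2 * R + 2 * suc j                     ≡⟨ cong (2 * R +_) (2*suc j) ⟩
    2 * R + suc (suc (2 * j))             ≡⟨ +-suc (2 * R) (suc (2 * j)) ⟩
    suc (2 * R) + suc (2 * j)             ∎))) right
    where
    open ≡-Reasoning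
    R = mirror h j
    2j<2h : 2 * j < 2 * h
    2j<2h = *-monoʳ-< 2 j<h
  mirror-child {h} {j} j<h right = subst (IsChild R) (sym (+-cancelʳ-≡ (suc (suc (2 * j))) _ _ (begin
    mirror (2 * h) (suc (2 * j)) + suc (suc (2 * j))  ≡⟨ mirror+suc 2j+1<2h ⟩
    2 * h                                             ≡⟨ double-mirror+suc j<h ⟩
    2 * R + 2 * suc j                                 ≡⟨ cong (2 * R +_) (2*suc j) ⟩
    2 * R + suc (suc (2 * j))                         ∎))) left
    where
    open ≡-Reasoning
    R = mirror h j
    2j+1<2h : suc (2 * j) < 2 * h
    2j+1<2h = subst (_≤ 2 * h) (2*suc j) (*-monoʳ-≤ 2 j<h)

  offset-child : ∀ e {j jc} → j < 2 ^ e → IsChild j jc → offset e j < offset (suc e) jc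
  offset-child e j< c = <-≤-trans (proj₂ (offset-inBlock e j<)) (proj₁ (offset-inBlock (suc e) (child-< {e} j< c)))

  treeEdges-noCrossing : ∀ {e j jc e' j' jc'} → j < 2 ^ e → IsChild j jc → j' < 2 ^ e' → IsChild j' jc' →
    isEven e ≡ isEven e' → ¬ Crossing (offset e j) (offset (suc e) jc) (offset e' j') (offset (suc e') jc')
  treeEdges-noCrossing {e} {j} {jc} {e'} {j'} {jc'} j< c j'< c' same (i₁ , i₂ , i₃) with <-cmp e e'
  ... | tri< e<e' _ _ with m≤n⇒m<n∨m≡n e<e'
  ...   | inj₁ 1+e<e' = <-irrefl refl (<-trans i₂ (<-≤-trans (proj₂ (offset-inBlock (suc e) (child-< {e} j< c)))
                          (≤-trans (^-monoʳ-≤ 2 1+e<e') (proj₁ (offset-inBlock e' j'<)))))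
  ...   | inj₂ refl = isEven-suc≢ e same
  treeEdges-noCrossing {e} {j} {jc} {e'} {j'} j< c j'< c' same (i₁ , i₂ , i₃) | tri> _ _ e'<e =
    <-irrefl refl (<-trans i₁ (<-≤-trans (proj₂ (offset-inBlock e' j'<))
                                          (≤-trans (^-monoʳ-≤ 2 e'<e) (proj₁ (offset-inBlock e j<)))))
  treeEdges-noCrossing {e} {j} {jc} {_} {j'} {jc'} j< c j'< c' same (i₁ , i₂ , i₃) | tri≈ _ refl _
    with <-cmp j j' | isEven-cases e
  ... | tri< j<j' _ _ | inj₁ p = <-asym i₃ (offset-antitone {suc e} (cong not p) (child-monotone c c' j<j') (child-< {e} j'< c'))
  ... | tri< j<j' _ _ | inj₂ p = <-asym i₁ (offset-antitone {e} p j<j' j'<)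
  ... | tri≈ _ refl _ | _      = <-irrefl refl i₁
  ... | tri> _ _ j'<j | inj₁ p = <-asym i₁ (offset-monotone {e} p j'<j)
  ... | tri> _ _ j'<j | inj₂ p = <-asym i₃ (offset-monotone {suc e} (cong not p) (child-monotone c' c j'<j))

  data ChordOffset (E : ℕ) : ℕ → Set where
    outer : ChordOffset E (2 ^ E ∸ 1)
    inner : ChordOffset E (2 ^ E)

  chordOffset≤ : ∀ {E o} → ChordOffset E o → o ≤ 2 ^ E
  chordOffset≤ {E} outer = m∸n≤m (2 ^ E) 1
  chordOffset≤ inner     = ≤-refl

  chordOffset≥ : ∀ {E o} → ChordOffset E o → 2 ^ E ≤ suc o
  chordOffset≥ {E} outer = ≤-reflexive (sym (trans (+-comm 1 (2 ^ E ∸ 1)) (m∸n+n≡m (m^n>0 2 E))))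
  chordOffset≥ inner     = n≤1+n _

  treeEdge-chord-noCrossing : ∀ {e j jc E o} → j < 2 ^ e → IsChild j jc → ChordOffset E o → isEven e ≡ isEven E →
    ¬ (offset e j < o × o < offset (suc e) jc)
  treeEdge-chord-noCrossing {e} {j} {jc} {E} j< c o same (i₁ , i₂) with <-cmp E (suc e)
  ... | tri< E<1+e _ _ = <-irrefl refl (<-≤-trans i₁ (≤-trans (chordOffset≤ o)
                           (≤-trans (^-monoʳ-≤ 2 (≤-pred E<1+e)) (proj₁ (offset-inBlock e j<)))))
  ... | tri≈ _ refl _  = isEven-suc≢ e same
  ... | tri> _ _ 1+e<E = <-irrefl refl (<-≤-trans i₂ (≤-pred (<-≤-trans (proj₂ (offset-inBlock (suc e) (child-< {e} j< c)))
                           (≤-trans (^-monoʳ-≤ 2 1+e<E) (chordOffset≥ o)))))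

module Layout (d : ℕ) where

  open DyadicBlocks
  open Offsets

  root : ℕ
  root = 2 ^ d

  size : ℕ
  size = suc (2 ^ suc d)

  -- a + o ≡ root stands for a = root − o, avoiding truncated subtraction.
  data Edge (a b : ℕ) : Set where
    path      : b ≡ suc a → Edge a b
    closing   : a ≡ 0 → b ≡ 2 ^ suc d → Edge a b
    leftTree  : ∀ e {j jc} → j < 2 ^ e → IsChild j jc →
                a + offset (suc e) jc ≡ root → b + offset e j ≡ root → Edge a b
    rightTree : ∀ e {j jc} → j < 2 ^ e → IsChild j jc →
                a ≡ root + offset e j → b ≡ root + offset (suc e) jc → Edge a b
    chord     : ∀ E {o} → ChordOffset E o → 1 ≤ E → a + o ≡ root → b ≡ root + o → Edge a b

  page : ℕ → ℕ → Bool
  page a b with b ≤? root | root ≤? a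
  ... | yes _ | _     = blockParity (root ∸ b)
  ... | no _  | yes _ = blockParity (a ∸ root)
  ... | no _  | no _  = blockParity (suc (root ∸ a))

  1≤offset : ∀ e {j} → j < 2 ^ e → 1 ≤ offset e j
  1≤offset e j< = ≤-trans (m^n>0 2 e) (proj₁ (offset-inBlock e j<))

  1≤chordOffset : ∀ {E o} → ChordOffset E o → 1 ≤ E → 1 ≤ o
  1≤chordOffset {suc E} outer _ = ∸-monoˡ-≤ 1 (^-monoʳ-≤ 2 {1} {suc E} (s≤s z≤n))
  1≤chordOffset {E}     inner _ = m^n>0 2 E

  chordOffset-inBlock : ∀ {E o} → ChordOffset E o → 1 ≤ E → InBlock E (suc o)
  chordOffset-inBlock {E} {o} c 1≤E = chordOffset≥ c , (begin-strict
    suc o             ≤⟨ s≤s (chordOffset≤ c) ⟩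
    suc (2 ^ E)       ≡⟨ +-comm 1 (2 ^ E) ⟩
    2 ^ E + 1         <⟨ +-monoʳ-< (2 ^ E) (^-monoʳ-< 2 (s≤s (s≤s z≤n)) {0} {E} 1≤E) ⟩
    2 ^ E + 2 ^ E     ≡⟨ sym (2^suc E) ⟩
    2 ^ suc E         ∎)
    where open ≤-Reasoning

  below-root : ∀ {a o} → a + o ≡ root → 1 ≤ o → a < root
  below-root {a} e 1≤o = subst (a <_) e (m<m+n a 1≤o)

  page-leftTree : ∀ {a b e j} → j < 2 ^ e → b + offset e j ≡ root → page a b ≡ isEven e
  page-leftTree {a} {b} {e} j< eq with b ≤? root | root ≤? a
  ... | yes _ | _ = trans (cong blockParity (trans (cong (_∸ b) (sym eq)) (m+n∸m≡n b _)))
                          (blockParity-block {e} (offset-inBlock e j<))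
  ... | no b≰root | _ = ⊥-elim (b≰root (subst (b ≤_) eq (m≤m+n b _)))

  page-rightTree : ∀ {a b e j jc} → j < 2 ^ e → IsChild j jc →
    a ≡ root + offset e j → b ≡ root + offset (suc e) jc → page a b ≡ isEven e
  page-rightTree {e = e} {j} {jc} j< c refl refl with root + offset (suc e) jc ≤? root | root ≤? root + offset e j
  ... | yes b≤root | _ =
    ⊥-elim (<-irrefl refl (<-≤-trans (m<m+n root (≤-trans (1≤offset e j<) (<⇒≤ (offset-child e j< c)))) b≤root))
  ... | no _ | yes _ = trans (cong blockParity (m+n∸m≡n root (offset e j))) (blockParity-block {e} (offset-inBlock e j<))
  ... | no _ | no root≰a = ⊥-elim (root≰a (m≤m+n root _))

  page-chord : ∀ {a b E o} → ChordOffset E o → 1 ≤ E → a + o ≡ root → b ≡ root + o → page a b ≡ isEven E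
  page-chord {a} {E = E} {o} c 1≤E eq refl with root + o ≤? root | root ≤? a
  ... | yes b≤root | _ = ⊥-elim (<-irrefl refl (<-≤-trans (m<m+n root (1≤chordOffset c 1≤E)) b≤root))
  ... | no _ | yes root≤a = ⊥-elim (<-irrefl refl (<-≤-trans (below-root eq (1≤chordOffset c 1≤E)) root≤a))
  ... | no _ | no _ = trans (cong (λ n → blockParity (suc n)) (trans (cong (_∸ a) (sym eq)) (m+n∸m≡n a o)))
                            (blockParity-block {E} (chordOffset-inBlock c 1≤E))

  edge< : ∀ {a b} → Edge a b → a < b
  edge< (path refl)                   = n<1+n _
  edge< (closing refl refl)           = m^n>0 2 (suc d)
  edge< (leftTree e j< c ea eb)       = m+n≡p+q⇒n<q⇒p<m (trans eb (sym ea)) (offset-child e j< c)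
  edge< (rightTree e j< c refl refl)  = +-monoʳ-< root (offset-child e j< c)
  edge< (chord E c 1≤E ea refl)       = <-≤-trans (below-root ea (1≤chordOffset c 1≤E)) (m≤m+n root _)

  edge-noCrossing : ∀ {a b a' b'} → b' < size → Edge a b → Edge a' b' → page a b ≡ page a' b' → ¬ Crossing a b a' b'
  edge-noCrossing _ (path refl) _ _ (a<a' , a'<1+a , _) = <-irrefl refl (<-≤-trans a<a' (≤-pred a'<1+a))
  edge-noCrossing _ _ (path refl) _ (_ , a'<b , b<1+a') = <-irrefl refl (<-≤-trans a'<b (≤-pred b<1+a'))
  edge-noCrossing b'<size (closing _ refl) _ _ (_ , _ , b<b') = <-irrefl refl (<-≤-trans b<b' (≤-pred b'<size))
  edge-noCrossing _ _ (closing refl _) _ (() , _ , _)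
  edge-noCrossing _ (leftTree e j< c ea eb) (leftTree e' j'< c' ea' eb') same (i₁ , i₂ , i₃) =
    treeEdges-noCrossing j'< c' j< c (trans (sym (page-leftTree j'< eb')) (trans (sym same) (page-leftTree j< eb)))
      (m+n≡p+q⇒m<p⇒q<n (trans eb (sym eb')) i₃ ,
       m+n≡p+q⇒m<p⇒q<n (trans ea' (sym eb)) i₂ ,
       m+n≡p+q⇒m<p⇒q<n (trans ea (sym ea')) i₁)
  edge-noCrossing _ (rightTree e j< c refl refl) (rightTree e' j'< c' refl refl) same (i₁ , i₂ , i₃) =
    treeEdges-noCrossing j< c j'< c' (trans (sym (page-rightTree j< c refl refl)) (trans same (page-rightTree j'< c' refl refl)))
      (+-cancelˡ-< root _ _ i₁ , +-cancelˡ-< root _ _ i₂ , +-cancelˡ-< root _ _ i₃)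
  edge-noCrossing {b = b} _ (leftTree e j< c ea eb) (rightTree e' j'< c' refl refl) _ (_ , a'<b , _) =
    <-irrefl refl (<-trans (<-≤-trans (below-root {b} eb (1≤offset e j<)) (m≤m+n root _)) a'<b)
  edge-noCrossing {a' = a'} _ (rightTree e j< c refl refl) (leftTree e' j'< c' ea' eb') _ (a<a' , _ , _) =
    <-irrefl refl (<-≤-trans (below-root {a'} ea' (≤-trans (1≤offset e' j'<) (<⇒≤ (offset-child e' j'< c'))))
                             (≤-trans (m≤m+n root _) (<⇒≤ a<a')))
  edge-noCrossing _ (leftTree e j< c ea eb) (chord E c' 1≤E ea' refl) same (i₁ , i₂ , _) =
    treeEdge-chord-noCrossing j< c c' (trans (sym (page-leftTree j< eb)) (trans same (page-chord c' 1≤E ea' refl)))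
      (m+n≡p+q⇒m<p⇒q<n (trans ea' (sym eb)) i₂ , m+n≡p+q⇒m<p⇒q<n (trans ea (sym ea')) i₁)
  edge-noCrossing {b' = b'} _ (chord E c 1≤E ea refl) (leftTree e' j'< c' ea' eb') _ (_ , _ , b<b') =
    <-irrefl refl (<-trans (<-≤-trans (below-root {b'} eb' (1≤offset e' j'<)) (m≤m+n root _)) b<b')
  edge-noCrossing _ (rightTree e j< c refl refl) (chord E c' 1≤E ea' refl) _ (a<a' , _ , _) =
    <-irrefl refl (<-trans (<-≤-trans (below-root ea' (1≤chordOffset c' 1≤E)) (m≤m+n root _)) a<a')
  edge-noCrossing _ (chord E c 1≤E ea refl) (rightTree e' j'< c' refl refl) same (_ , i₂ , i₃) =
    treeEdge-chord-noCrossing j'< c' c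
      (trans (sym (page-rightTree j'< c' refl refl)) (trans (sym same) (page-chord c 1≤E ea refl)))
      (+-cancelˡ-< root _ _ i₂ , +-cancelˡ-< root _ _ i₃)
  edge-noCrossing _ (chord E c 1≤E ea refl) (chord E' c' 1≤E' ea' refl) _ (a<a' , _ , b<b') =
    <-asym (m+n≡p+q⇒m<p⇒q<n (trans ea (sym ea')) a<a') (+-cancelˡ-< root _ _ b<b')

  spineBookEmbedding : TwoPageBookEmbedding size Edge
  spineBookEmbedding = record { page = page ; endpoints< = edge< ; noCrossing = λ _ → edge-noCrossing }

  position : ℕ → ℕ → ℕ
  position zero    J = root
  position (suc e) J with J <? 2 ^ e
  ... | yes _ = root ∸ offset e J
  ... | no _  = root + offset e (mirror (2 ^ suc e) J)

  position-left : ∀ {e J} → J < 2 ^ e → position (suc e) J ≡ root ∸ offset e J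
  position-left {e} {J} J< with J <? 2 ^ e
  ... | yes _ = refl
  ... | no J≮ = ⊥-elim (J≮ J<)

  position-right : ∀ {e J} → ¬ J < 2 ^ e → position (suc e) J ≡ root + offset e (mirror (2 ^ suc e) J)
  position-right {e} {J} J≮ with J <? 2 ^ e
  ... | yes J< = ⊥-elim (J≮ J<)
  ... | no _   = refl

  offset<root : ∀ {e J} → suc e ≤ d → J < 2 ^ e → offset e J < root
  offset<root {e} 1+e≤d J< = <-≤-trans (proj₂ (offset-inBlock e J<)) (^-monoʳ-≤ 2 1+e≤d)

  position+offset≡root : ∀ {e J} → suc e ≤ d → J < 2 ^ e → position (suc e) J + offset e J ≡ root
  position+offset≡root {e} {J} 1+e≤d J< =
    trans (cong (_+ offset e J) (position-left J<)) (m∸n+n≡m (<⇒≤ (offset<root 1+e≤d J<)))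

  mirror-rightHalf : ∀ {e J} → 2 ^ e ≤ J → J < 2 ^ suc e → mirror (2 ^ suc e) J < 2 ^ e
  mirror-rightHalf {e} {J} 2^e≤J J< = m+n≡p+q⇒n<q⇒p<m (trans (sym (2^suc e)) (sym (mirror+suc J<))) (s≤s 2^e≤J)

  data Placed (k J p : ℕ) : Set where
    atRoot  : k ≡ 0 → J ≡ 0 → p ≡ root → Placed k J p
    onLeft  : ∀ e → k ≡ suc e → J < 2 ^ e → p + offset e J ≡ root → Placed k J p
    onRight : ∀ e R → k ≡ suc e → R < 2 ^ e → R + suc J ≡ 2 ^ suc e → p ≡ root + offset e R → Placed k J p

  placed : ∀ k J → k ≤ d → J < 2 ^ k → Placed k J (position k J)
  placed zero .0 _ (s≤s z≤n) = atRoot refl refl refl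
  placed (suc e) J k≤d J< with J <? 2 ^ e
  ... | yes J<2^e = onLeft e refl J<2^e (m∸n+n≡m (<⇒≤ (offset<root k≤d J<2^e)))
  ... | no J≮2^e  = onRight e _ refl (mirror-rightHalf {e} (≮⇒≥ J≮2^e) J<) (mirror+suc J<) refl

  root≢root+offset : ∀ {e J} → J < 2 ^ e → root ≢ root + offset e J
  root≢root+offset {e} J< eq = <-irrefl eq (m<m+n root (1≤offset e J<))

  placed-injective : ∀ {k J k' J' p} → Placed k J p → Placed k' J' p → k ≡ k' × J ≡ J'
  placed-injective (atRoot refl refl _) (atRoot refl refl _) = refl , refl
  placed-injective (atRoot _ _ refl) (onLeft e _ J< eq) = ⊥-elim (root≢root+offset J< (sym eq))
  placed-injective (atRoot _ _ refl) (onRight e R _ R< _ eq) = ⊥-elim (root≢root+offset R< eq)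
  placed-injective (onLeft e _ J< eq) (atRoot _ _ refl) = ⊥-elim (root≢root+offset J< (sym eq))
  placed-injective (onRight e R _ R< _ eq) (atRoot _ _ refl) = ⊥-elim (root≢root+offset R< eq)
  placed-injective {p = p} (onLeft e refl J< eq) (onLeft e' refl J'< eq')
    with offset-eq ← +-cancelˡ-≡ p _ _ (trans eq (sym eq'))
    with refl ← block-unique {e} {e'} (offset-inBlock e J<) (subst (InBlock e') (sym offset-eq) (offset-inBlock e' J'<))
    = refl , offset-injective J< J'< offset-eq
  placed-injective (onRight e R refl R< R+ refl) (onRight e' R' refl R'< R'+ eq')
    with offset-eq ← +-cancelˡ-≡ root _ _ eq'
    with refl ← block-unique {e} {e'} (offset-inBlock e R<) (subst (InBlock e') (sym offset-eq) (offset-inBlock e' R'<))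
    with refl ← offset-injective R< R'< offset-eq
    = refl , suc-injective (+-cancelˡ-≡ R _ _ (trans R+ (sym R'+)))
  placed-injective (onLeft e _ J< eq) (onRight e' R _ R< _ refl) =
    ⊥-elim (<-irrefl (sym eq) (≤-trans (m<m+n root (1≤offset e J<)) (+-monoˡ-≤ (offset e _) (m≤m+n root _))))
  placed-injective (onRight e R _ R< _ refl) (onLeft e' _ J'< eq) =
    ⊥-elim (<-irrefl (sym eq) (≤-trans (m<m+n root (1≤offset e' J'<)) (+-monoˡ-≤ (offset e' _) (m≤m+n root _))))

  position<size : ∀ {k J p} → k ≤ d → Placed k J p → p < size
  position<size _ (atRoot _ _ refl) = s≤s (m≤m+n root _)
  position<size _ (onLeft e _ _ eq) = s≤s (≤-trans (subst (_ ≤_) eq (m≤m+n _ _)) (m≤m+n root _))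
  position<size k≤d (onRight e R refl R< _ refl) =
    s≤s (≤-trans (+-monoʳ-≤ root (<⇒≤ (offset<root k≤d R<))) (≤-reflexive (cong (root +_) (sym (+-identityʳ root)))))

  Adjacent : ℕ → ℕ → Set
  Adjacent p q = Edge p q ⊎ Edge q p

  offset-0-0 : offset 0 0 ≡ 1
  offset-0-0 = offset-even {0} 0 refl

  treeEdge-adjacent : ∀ k {J Jc} → IsChild J Jc → suc k ≤ d → J < 2 ^ k → Adjacent (position k J) (position (suc k) Jc)
  treeEdge-adjacent zero {Jc = .0} left 1≤d (s≤s z≤n) = inj₂ (path (begin
    root                    ≡⟨ sym (m∸n+n≡m (m^n>0 2 d)) ⟩
    root ∸ 1 + 1            ≡⟨ +-comm (root ∸ 1) 1 ⟩
    suc (root ∸ 1)          ≡⟨ cong (λ o → suc (root ∸ o)) (sym offset-0-0) ⟩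
    suc (root ∸ offset 0 0) ≡⟨ cong suc (sym (position-left {0} (s≤s z≤n))) ⟩
    suc (position 1 0)      ∎))
    where open ≡-Reasoning
  treeEdge-adjacent zero {Jc = .1} right 1≤d (s≤s z≤n) = inj₁ (path (begin
    position 1 1            ≡⟨ position-right {0} {1} (λ { (s≤s ()) }) ⟩
    root + offset 0 0       ≡⟨ cong (root +_) offset-0-0 ⟩
    root + 1                ≡⟨ +-comm root 1 ⟩
    suc root                ∎))
    where open ≡-Reasoning
  treeEdge-adjacent (suc e) {J} {Jc} c 2+e≤d J< = byHalf (J <? 2 ^ e)
    where
    byHalf : Dec (J < 2 ^ e) → Adjacent (position (suc e) J) (position (suc (suc e)) Jc)
    byHalf (yes J<2^e) = inj₂ (leftTree e J<2^e c (position+offset≡root 2+e≤d (child-< {e} J<2^e c))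
                                                   (position+offset≡root (≤-trans (n≤1+n _) 2+e≤d) J<2^e))
    byHalf (no J≮2^e) = inj₁ (rightTree e (mirror-rightHalf {e} 2^e≤J J<) (mirror-child J< c)
                                          (position-right {e} J≮2^e) (position-right {suc e} Jc≮))
      where
      2^e≤J : 2 ^ e ≤ J
      2^e≤J = ≮⇒≥ J≮2^e
      Jc≮ : ¬ Jc < 2 ^ suc e
      Jc≮ Jc< = <-irrefl refl (<-≤-trans Jc< (≤-trans (*-monoʳ-≤ 2 2^e≤J) (child≥ c)))

  ChordEnd : ℕ → Set
  ChordEnd o = ∃ λ E → ChordOffset E o × 1 ≤ E

  offset-last-chordEnd : ∀ e {j} → suc j ≡ 2 ^ e → ChordEnd (offset e j)
  offset-last-chordEnd e {j} 1+j≡2^e with isEven-cases e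
  ... | inj₁ p = suc e , subst (ChordOffset (suc e)) (sym (begin
    offset e j               ≡⟨ offset-even j p ⟩
    2 ^ e + j                ≡⟨ sym (+-∸-assoc (2 ^ e) (s≤s z≤n)) ⟩
    2 ^ e + suc j ∸ 1        ≡⟨ cong (λ n → 2 ^ e + n ∸ 1) 1+j≡2^e ⟩
    2 ^ e + 2 ^ e ∸ 1        ≡⟨ cong (_∸ 1) (sym (2^suc e)) ⟩
    2 ^ suc e ∸ 1            ∎)) outer , s≤s z≤n
    where open ≡-Reasoning
  ... | inj₂ p = e , subst (ChordOffset e) (sym (begin
    offset e j               ≡⟨ offset-odd j p ⟩
    2 ^ e + (2 ^ e ∸ suc j)  ≡⟨ cong (λ n → 2 ^ e + (n ∸ suc j)) (sym 1+j≡2^e) ⟩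
    2 ^ e + (suc j ∸ suc j)  ≡⟨ cong (2 ^ e +_) (n∸n≡0 (suc j)) ⟩
    2 ^ e + 0                ≡⟨ +-identityʳ (2 ^ e) ⟩
    2 ^ e                    ∎)) inner , odd⇒1≤ e p
    where
    open ≡-Reasoning
    odd⇒1≤ : ∀ e → isEven e ≡ false → 1 ≤ e
    odd⇒1≤ (suc e) _ = s≤s z≤n

  offset-first-chordEnd : ∀ e → 1 ≤ e → ChordEnd (offset e 0)
  offset-first-chordEnd e 1≤e with isEven-cases e
  ... | inj₁ p = e , subst (ChordOffset e) (sym (trans (offset-even 0 p) (+-identityʳ (2 ^ e)))) inner , 1≤e
  ... | inj₂ p = suc e , subst (ChordOffset (suc e)) (sym (begin
    offset e 0               ≡⟨ offset-odd 0 p ⟩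
    2 ^ e + (2 ^ e ∸ 1)      ≡⟨ sym (+-∸-assoc (2 ^ e) (m^n>0 2 e)) ⟩
    2 ^ e + 2 ^ e ∸ 1        ≡⟨ cong (_∸ 1) (sym (2^suc e)) ⟩
    2 ^ suc e ∸ 1            ∎)) outer , s≤s z≤n
    where open ≡-Reasoning

  neighbours-adjacent : ∀ {p q o o'} → p + o ≡ root → q + o' ≡ root → o' ≡ suc o ⊎ o ≡ suc o' → Adjacent p q
  neighbours-adjacent {p} {q} {o} p+o q+o' (inj₁ refl) =
    inj₂ (path (+-cancelʳ-≡ o _ _ (trans p+o (sym (trans (sym (+-suc q o)) q+o')))))
  neighbours-adjacent {p} {q} {o' = o'} p+o q+o' (inj₂ refl) =
    inj₁ (path (+-cancelʳ-≡ o' _ _ (trans q+o' (sym (trans (sym (+-suc p o')) p+o)))))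

  rightNeighbours-adjacent : ∀ {p q o o'} → p ≡ root + o → q ≡ root + o' → o ≡ suc o' ⊎ o' ≡ suc o → Adjacent p q
  rightNeighbours-adjacent {o' = o'} refl refl (inj₁ refl) = inj₂ (path (+-suc root o'))
  rightNeighbours-adjacent {o = o}   refl refl (inj₂ refl) = inj₁ (path (+-suc root o))

  mirror-middle : ∀ {e J} → suc J ≡ 2 ^ e → mirror (2 ^ suc e) (suc J) ≡ J
  mirror-middle {e} {J} 1+J≡2^e = +-cancelʳ-≡ (suc (suc J)) _ _ (begin
    mirror (2 ^ suc e) (suc J) + suc (suc J)  ≡⟨ mirror+suc (subst (_< 2 ^ suc e) (sym 1+J≡2^e) (^-monoʳ-< 2 (s≤s (s≤s z≤n)) (n<1+n e))) ⟩
    2 ^ suc e                                 ≡⟨ 2^suc e ⟩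
    2 ^ e + 2 ^ e                             ≡⟨ cong₂ _+_ (sym 1+J≡2^e) (sym 1+J≡2^e) ⟩
    suc J + suc J                             ≡⟨ +-suc (suc J) J ⟩
    suc (suc J) + J                           ≡⟨ +-comm (suc (suc J)) J ⟩
    J + suc (suc J)                           ∎)
    where open ≡-Reasoning

  horizontalEdge-adjacent : ∀ e J → suc J < 2 ^ suc e → suc e ≤ d →
    Adjacent (position (suc e) J) (position (suc e) (suc J))
  horizontalEdge-adjacent e J 1+J< 1+e≤d = byHalves (J <? 2 ^ e) (suc J <? 2 ^ e)
    where
    byHalves : Dec (J < 2 ^ e) → Dec (suc J < 2 ^ e) → Adjacent (position (suc e) J) (position (suc e) (suc J))
    byHalves (yes J<) (yes 1+J<) =
      neighbours-adjacent (position+offset≡root 1+e≤d J<) (position+offset≡root 1+e≤d 1+J<) (offset-suc 1+J<)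
    byHalves (yes J<) (no 1+J≮) with E , c , 1≤E ← offset-last-chordEnd e (≤-antisym J< (≮⇒≥ 1+J≮)) =
      inj₁ (chord E c 1≤E (position+offset≡root 1+e≤d J<)
        (trans (position-right 1+J≮) (cong (λ R → root + offset e R) (mirror-middle {e} (≤-antisym J< (≮⇒≥ 1+J≮))))))
    byHalves (no J≮) (yes 1+J<) = ⊥-elim (J≮ (<-trans (n<1+n J) 1+J<))
    byHalves (no J≮) (no 1+J≮) = rightNeighbours-adjacent
      (trans (position-right J≮) (cong (λ R → root + offset e R) (mirror-suc 1+J<)))
      (position-right 1+J≮)
      (offset-suc {e} (subst (_< 2 ^ e) (mirror-suc 1+J<) (mirror-rightHalf {e} (≮⇒≥ J≮) (<-trans (n<1+n J) 1+J<))))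

  wrapEdge-adjacent : ∀ k j → suc j ≡ 2 ^ k → 2 ≤ j → k ≤ d → Adjacent (position k 0) (position k j)
  wrapEdge-adjacent zero       .0 refl () _
  wrapEdge-adjacent (suc zero) .1 refl (s≤s ()) _
  wrapEdge-adjacent (suc (suc e')) j 1+j≡2^k _ k≤d with E , c , 1≤E ← offset-first-chordEnd (suc e') (s≤s z≤n) =
    inj₁ (chord E c 1≤E (position+offset≡root k≤d (m^n>0 2 e))
      (trans (position-right j≮) (cong (λ R → root + offset e R) mirror-last≡0)))
    where
    e = suc e'
    mirror-last≡0 : mirror (2 ^ suc e) j ≡ 0
    mirror-last≡0 = trans (cong (2 ^ suc e ∸_) 1+j≡2^k) (n∸n≡0 (2 ^ suc e))
    j≮ : ¬ j < 2 ^ e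
    j≮ j< = <⇒≱ (^-monoʳ-< 2 (s≤s (s≤s z≤n)) (n<1+n e)) (subst (_≤ 2 ^ e) 1+j≡2^k j<)

  extStep-adjacent : ∀ {k J k' J'} → k ≤ d → k' ≤ d → J < 2 ^ k → J' < 2 ^ k' → ExtStep k J k' J' →
    Adjacent (position k J) (position k' J')
  extStep-adjacent k≤d _    _  _        (wrap k j 1+j≡2^k 2≤j)        = wrapEdge-adjacent k j 1+j≡2^k 2≤j k≤d
  extStep-adjacent _   k'≤d J< _        (base (leftChild k j))        = treeEdge-adjacent k left k'≤d J<
  extStep-adjacent _   k'≤d J< _        (base (rightChild k j))       = treeEdge-adjacent k right k'≤d J<
  extStep-adjacent _   _    _  (s≤s ()) (base (horizontal zero j))
  extStep-adjacent k≤d _    _  1+j<     (base (horizontal (suc e) j)) = horizontalEdge-adjacent e j 1+j< k≤d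

module XTreeLayout (d : ℕ) where

  open Layout d

  depth≤d : (k : Fin (suc d)) → toℕ k ≤ d
  depth≤d k = ≤-pred (Fin.toℕ<n k)

  vertex : XVertex d → Fin size
  vertex (k , J) = fromℕ< (position<size (depth≤d k) (placed (toℕ k) (toℕ J) (depth≤d k) (Fin.toℕ<n J)))

  toℕ-vertex : ∀ x → toℕ (vertex x) ≡ position (toℕ (proj₁ x)) (toℕ (proj₂ x))
  toℕ-vertex (k , J) = Fin.toℕ-fromℕ< _

  xVertex-≡ : ∀ {k k' : Fin (suc d)} {J : Fin (2 ^ toℕ k)} {J' : Fin (2 ^ toℕ k')} →
    toℕ k ≡ toℕ k' → toℕ J ≡ toℕ J' → _≡_ {A = XVertex d} (k , J) (k' , J')
  xVertex-≡ k≡k' J≡J' with refl ← Fin.toℕ-injective k≡k' = cong (_ ,_) (Fin.toℕ-injective J≡J')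

  vertex-injective : Injective _≡_ _≡_ vertex
  vertex-injective {k , J} {k' , J'} eq = uncurry xVertex-≡ (placed-injective
    (placed (toℕ k) (toℕ J) (depth≤d k) (Fin.toℕ<n J))
    (subst (Placed (toℕ k') (toℕ J'))
      (trans (sym (toℕ-vertex (k' , J'))) (trans (cong toℕ (sym eq)) (toℕ-vertex (k , J))))
      (placed (toℕ k') (toℕ J') (depth≤d k') (Fin.toℕ<n J'))))

  vertex-adjacent : ∀ u v → Graph.Adj (ExtXTree d) u v → Undirected Edge (vertex u) (vertex v)
  vertex-adjacent (k , J) (k' , J') adj =
    subst₂ Adjacent (sym (toℕ-vertex (k , J))) (sym (toℕ-vertex (k' , J'))) (byDirection adj)
    where
    byDirection : Graph.Adj (ExtXTree d) (k , J) (k' , J') →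
      Adjacent (position (toℕ k) (toℕ J)) (position (toℕ k') (toℕ J'))
    byDirection (inj₁ step) = extStep-adjacent (depth≤d k) (depth≤d k') (Fin.toℕ<n J) (Fin.toℕ<n J') step
    byDirection (inj₂ step) = swap⊎ (extStep-adjacent (depth≤d k') (depth≤d k) (Fin.toℕ<n J') (Fin.toℕ<n J) step)

  spineCycle : HamiltonianCycle size (Undirected Edge)
  spineCycle = record
    { three≤m = s≤s (^-monoʳ-≤ 2 {1} {suc d} (s≤s z≤n))
    ; c = id
    ; c-inj = id
    ; c-adj = λ { i j (inj₁ 1+i≡j) → inj₁ (path (sym 1+i≡j))
                ; i j (inj₂ (1+i≡size , j≡0)) → inj₂ (closing j≡0 (suc-injective 1+i≡size)) } }

  extXTree-subhamiltonian : Subhamiltonian (ExtXTree d)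
  extXTree-subhamiltonian =
    size , Undirected Edge , undirected-simple edge< , bookEmbedding⇒planar spineBookEmbedding , spineCycle ,
    vertex , vertex-injective , vertex-adjacent

subhamiltonian-subgraph : ∀ {G G' : Graph} (f : Graph.V G → Graph.V G') → Injective _≡_ _≡_ f →
  (∀ u v → Graph.Adj G u v → Graph.Adj G' (f u) (f v)) → Subhamiltonian G' → Subhamiltonian G
subhamiltonian-subgraph f f-inj f-adj (m , H , simple , planar , cycle , g , g-inj , g-adj) =
  m , H , simple , planar , cycle , g ∘ f , f-inj ∘ g-inj , λ u v adj → g-adj _ _ (f-adj u v adj)

xTree⊆extXTree : ∀ {d} u v → Graph.Adj (XTree d) u v → Graph.Adj (ExtXTree d) u v
xTree⊆extXTree _ _ = ⊎-map base base

corollary1 : (d : ℕ) → Subhamiltonian (ExtXTree d) × Subhamiltonian (XTree d)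
corollary1 d = extXTree , subhamiltonian-subgraph id id xTree⊆extXTree extXTree
  where
  extXTree : Subhamiltonian (ExtXTree d)
  extXTree = XTreeLayout.extXTree-subhamiltonian d
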